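{- Let $j$ and $n$ be positive integers and let $G_{j,n}$ be any graph of the form described in the context. Let $w\in\left[\frac12,1\right)$ with $w<\frac{j}{j+2}$. Then the $w$-power index process on $G_{j,n}$ with initial configuration \[C_0(v)=\begin{cases} C & v\in K_j,\\ D & \text{otherwise}\end{cases}\] is collaborator dominant.
   Context: All graphs are finite and simple. A configuration of a graph $G$ is a map $C:V(G)\to\{C,D\}$; vertices with value $C$ are collaborators, those with value $D$ defectors. $N[v]$ is the closed neighbourhood of $v$, $N_C[v]$ is the set of collaborators in $N[v]$ and $N_D[v]$ the set of defectors in $N[v]$. Fix a win condition $w\in\left[\frac12,1\right)$. The power of $v$ with respect to a configuration is: if $v$ is a collaborator, $p(v)=1/|N_C[v]|$ when $|N_C[v]|/|N[v]|>w$ and $p(v)=0$ otherwise; if $v$ is a defector, $p(v)=1/|N_D[v]|$ when $|N_C[v]|/|N[v]|\le w$ and $p(v)=0$ otherwise. The $w$-power index process with initial configuration $C_0$ produces configurations $C_1,C_2,\dots$: for $t\ge1$ each vertex $v$ simultaneously takes the strategy (value) that, in $C_{t-1}$, is held by the vertex of $N[v]$ of greatest power (powers computed with respect to $C_{t-1}$); if the vertices of $N[v]$ of greatest power have differing strategies, then $C_t(v)=C_{t-1}(v)$. The process (or $C_0$) is collaborator dominant if there is $i\ge0$ with $C_i=C_{i+1}$ and $C_i(v)=C$ for every vertex $v$. The graph $G_{j,n}$: take the disjoint union of $n+1$ cliques $K_j,K_{2j},K_{2^2j},\dots,K_{2^nj}$ and add edges only between successive cliques so that each vertex of $K_j$ has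 exactly two neighbours in $K_{2j}$; for $1\le i\le n-1$ each vertex of $K_{2^ij}$ has exactly two neighbours in $K_{2^{i+1}j}$ and exactly one neighbour in $K_{2^{i-1}j}$; and each vertex of $K_{2^nj}$ has exactly one neighbour in $K_{2^{n-1}j}$.
   Formalization: The win condition $w$ ranges over the rationals. -}

module Defs where

open import Data.Bool using (Bool; true; false; _∧_; _∨_; not; if_then_else_)
open import Data.Nat as ℕ using (ℕ; zero; suc; _^_; _≡ᵇ_) renaming (_*_ to _*ℕ_; _≤_ to _≤ℕ_; _<_ to _<ℕ_)
open import Data.Fin using (Fin; _≟_)
open import Data.List using (List; length; filterᵇ; foldr)
open import Data.Bool.ListAction using (any)
open import Data.List.Base using (allFin)
open import Data.Integer using (+_)
open import Data.Rational using (ℚ; _/_; 0ℚ; _⊔_; _<_)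
open import Data.Rational.Properties using (_<?_) renaming (_≟_ to _≟ℚ_)
open import Data.Product using (∃; _,_; _×_)
open import Data.Sum using (_⊎_)
open import Relation.Nullary using (¬_; does)
open import Relation.Binary.PropositionalEquality using (_≡_; _≢_)

data Strat : Set where
  C D : Strat

isC : Strat → Bool
isC C = true
isC D = false

record Graph (N : ℕ) : Set where
  field
    adj     : Fin N → Fin N → Bool
    sym     : ∀ u v → adj u v ≡ adj v u
    irrefl  : ∀ v → adj v v ≡ false

Config : ℕ → Set
Config N = Fin N → Strat

module _ {N : ℕ} (G : Graph N) where
  open Graph G

  inN : Fin N → Fin N → Bool
  inN v u = does (u ≟ v) ∨ adj v u

  countN : Fin N → (Fin N → Bool) → ℕ
  countN v p = length (filterᵇ (λ u → inN v u ∧ p u) (allFin N))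

  countNbr : Fin N → (Fin N → Bool) → ℕ
  countNbr v p = length (filterᵇ (λ u → adj v u ∧ p u) (allFin N))

  -- |N[v]| = 1 + deg v ;  |N_C[v]| = [v ∈ C] + #C-neighbours, etc.
  module _ (w : ℚ) (c : Config N) where
    ratioC : Fin N → ℚ
    ratioC v = + countN v (λ u → isC (c u)) / suc (countNbr v (λ _ → true))

    wins : Fin N → Bool
    wins v = does (w <? ratioC v)

    power : Fin N → ℚ
    power v with c v | wins v
    ... | C | true  = + 1 / suc (countNbr v (λ u → isC (c u)))
    ... | C | false = 0ℚ
    ... | D | true  = 0ℚ
    ... | D | false = + 1 / suc (countNbr v (λ u → not (isC (c u))))

    maxPower : Fin N → ℚ
    maxPower v = foldr (λ u m → if inN v u then power u ⊔ m else m) 0ℚ (allFin N)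

    isMax : Fin N → Fin N → Bool
    isMax v u = inN v u ∧ does (power u ≟ℚ maxPower v)

    step : Config N
    step v with any (λ u → isMax v u ∧ isC (c u)) (allFin N)
              | any (λ u → isMax v u ∧ not (isC (c u))) (allFin N)
    ... | true  | false = C
    ... | false | true  = D
    ... | _     | _     = c v

  process : ℚ → Config N → ℕ → Config N
  process w c zero    = c
  process w c (suc t) = step w (process w c t)

  CollaboratorDominant : ℚ → Config N → Set
  CollaboratorDominant w c =
    ∃ λ i → (∀ v → process w c i v ≡ process w c (suc i) v)
          × (∀ v → process w c i v ≡ C)

-- G is a graph of the form G_{j,n}: `layer v = i` means v lies in the clique K_{2^i j}.
record IsGjn (j n : ℕ) {N : ℕ} (G : Graph N) (layer : Fin N → ℕ) : Set where
  open Graph G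
  field
    layer≤     : ∀ v → layer v ≤ℕ n
    layerSize  : ∀ i → i ≤ℕ n →
                 length (filterᵇ (λ v → layer v ≡ᵇ i) (allFin N)) ≡ (2 ^ i) *ℕ j
    clique     : ∀ u v → u ≢ v → layer u ≡ layer v → adj u v ≡ true
    onlySucc   : ∀ u v → adj u v ≡ true →
                 layer u ≡ layer v ⊎ suc (layer u) ≡ layer v ⊎ layer u ≡ suc (layer v)
    twoUp      : ∀ v → layer v <ℕ n →
                 countNbr G v (λ u → layer u ≡ᵇ suc (layer v)) ≡ 2
    oneDown    : ∀ v → 1 ≤ℕ layer v →
                 countNbr G v (λ u → suc (layer u) ≡ᵇ layer v) ≡ 1

initConfig : ∀ {N} → (Fin N → ℕ) → Config N
initConfig layer v with layer v
... | zero  = C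
... | suc _ = D

-- Layer i of G_{j,n} is the clique K_{2^i j}.  Call a configuration the front at depth t
-- when exactly the layers 0, …, t collaborate.  One round of the process turns the front
-- at depth t into the front at depth t+1, so after n rounds everybody collaborates and the
-- all-collaborator configuration is fixed.  In a front configuration every collaborator
-- wins (at most two defecting neighbours, all in the layer above, so its collaborator ratio
-- is at least j/(j+2) > w) and every defector loses (at most one collaborating neighbour,
-- so its ratio is at most ½ ≤ w).  Powers are therefore 1/|N_C[x]| and 1/|N_D[u]|, and
-- since layer sizes double, a collaborator of layer t is more powerful than any defector.
-- Hence no vertex of greatest power next to layer t defects, and layer t+1 switches.
module Submission where

open import Defs
open import Data.Nat using (ℕ; suc; NonZero)
open import Data.Fin using (Fin)
open import Data.Integer using (+_)
open import Data.Rational using (ℚ; ½; 1ℚ; _≤_; _<_; _/_)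

open import Data.Bool using (Bool; true; false; _∧_; _∨_; not; if_then_else_)
open import Data.Bool.Properties using (T-≡; ∨-zeroʳ; ∧-conicalˡ; ∧-conicalʳ; ∧-zeroʳ; ∧-identityʳ; ∧-assoc; ∧-distribˡ-∨)
open import Data.Bool.ListAction using (any)
open import Data.Nat as ℕ using (zero; _+_; _*_; _^_; _≡ᵇ_; z≤n; s≤s) renaming (_≤_ to _≤ℕ_; _<_ to _<ℕ_)
import Data.Nat.Properties as ℕP
open import Data.Fin as Fin using (zero; suc) renaming (_≟_ to _≟F_)
open import Data.List using (List; []; _∷_; length; filterᵇ; foldr; tabulate; allFin)
open import Data.List.Membership.Propositional using (_∈_)
open import Data.List.Membership.Propositional.Properties using (∈-allFin)
open import Data.List.Relation.Unary.Any using (here; there)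
open import Data.Product using (∃; _,_; _×_; proj₁; proj₂)
open import Data.Sum using (_⊎_; inj₁; inj₂; [_,_])
open import Data.Empty using (⊥-elim)
open import Function using (_∘_; Equivalence)
open import Relation.Nullary using (¬_; Dec; does; yes; no)
open import Relation.Nullary.Decidable using (dec-true; dec-false)
open import Relation.Binary.PropositionalEquality
import Data.Integer as ℤ
import Data.Integer.Properties as ℤP
open import Data.Rational using (0ℚ; _⊔_)
open import Data.Rational.Properties as ℚP using (_<?_) renaming (_≟_ to _≟ℚ_)
import Data.Rational.Unnormalised as ℚᵘ
import Data.Rational.Unnormalised.Properties as ℚᵘP

module _ {A : Set} where

  count : (A → Bool) → List A → ℕ
  count f xs = length (filterᵇ f xs)

  count-cong : ∀ (f g : A → Bool) xs → (∀ x → f x ≡ g x) → count f xs ≡ count g xs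
  count-cong f g [] f≗g = refl
  count-cong f g (x ∷ xs) f≗g rewrite f≗g x with g x
  ... | true  = cong suc (count-cong f g xs f≗g)
  ... | false = count-cong f g xs f≗g

  count-mono : ∀ (f g : A → Bool) xs → (∀ x → f x ≡ true → g x ≡ true) → count f xs ≤ℕ count g xs
  count-mono f g [] f⇒g = z≤n
  count-mono f g (x ∷ xs) f⇒g with f x | g x | f⇒g x
  ... | true  | true  | _   = s≤s (count-mono f g xs f⇒g)
  ... | false | true  | _   = ℕP.m≤n⇒m≤1+n (count-mono f g xs f⇒g)
  ... | false | false | _   = count-mono f g xs f⇒g
  ... | true  | false | fx⇒gx with () ← fx⇒gx refl

  count-none : ∀ (f : A → Bool) xs → (∀ x → f x ≡ false) → count f xs ≡ 0
  count-none f [] none = refl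
  count-none f (x ∷ xs) none rewrite none x = count-none f xs none

  count-split : ∀ (f g : A → Bool) xs → count f xs ≡ count (λ x → f x ∧ g x) xs + count (λ x → f x ∧ not (g x)) xs
  count-split f g [] = refl
  count-split f g (x ∷ xs) with f x | g x
  ... | true  | true  = cong suc (count-split f g xs)
  ... | true  | false = trans (cong suc (count-split f g xs)) (sym (ℕP.+-suc _ _))
  ... | false | _     = count-split f g xs

  count-∨ : ∀ (f g : A → Bool) xs → count (λ x → f x ∨ g x) xs ≤ℕ count f xs + count g xs
  count-∨ f g [] = z≤n
  count-∨ f g (x ∷ xs) with f x | g x
  ... | true  | false = s≤s (count-∨ f g xs)
  ... | true  | true  = s≤s (ℕP.≤-trans (count-∨ f g xs) (ℕP.+-monoʳ-≤ (count f xs) (ℕP.n≤1+n _)))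
  ... | false | true  = ℕP.≤-trans (s≤s (count-∨ f g xs)) (ℕP.≤-reflexive (sym (ℕP.+-suc _ _)))
  ... | false | false = count-∨ f g xs

  count-witness : ∀ (f : A → Bool) xs → count f xs ≢ 0 → ∃ λ x → f x ≡ true
  count-witness f [] nonzero = ⊥-elim (nonzero refl)
  count-witness f (x ∷ xs) nonzero with f x in fx
  ... | true  = x , fx
  ... | false = count-witness f xs nonzero

count-tabulate : ∀ {B : Set} {n} (f : B → Bool) (h : Fin n → B) → count f (tabulate h) ≡ count (f ∘ h) (allFin n)
count-tabulate {n = zero} f h = refl
count-tabulate {n = suc n} f h with f (h zero)
... | true  = cong suc (trans (count-tabulate f (h ∘ suc)) (sym (count-tabulate (f ∘ h) suc)))
... | false = trans (count-tabulate f (h ∘ suc)) (sym (count-tabulate (f ∘ h) suc))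

count-self : ∀ {N} (v : Fin N) → count (λ u → does (u ≟F v)) (allFin N) ≡ 1
count-self {suc N} zero rewrite count-tabulate (λ u → does (u ≟F zero)) (suc {N}) =
  cong suc (count-none _ (allFin N) (λ _ → refl))
count-self {suc N} (suc v) rewrite count-tabulate (λ u → does (u ≟F suc v)) (suc {N}) = count-self v

frac-≤ : (a b c d : ℕ) → a * suc d ≤ℕ c * suc b → + a / suc b ≤ + c / suc d
frac-≤ a b c d h = ℚP.toℚᵘ-cancel-≤
  (ℚᵘP.≤-respˡ-≃ (ℚᵘP.≃-sym (ℚP.toℚᵘ-fromℚᵘ (ℚᵘ.mkℚᵘ (+ a) b)))
    (ℚᵘP.≤-respʳ-≃ (ℚᵘP.≃-sym (ℚP.toℚᵘ-fromℚᵘ (ℚᵘ.mkℚᵘ (+ c) d)))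
      (ℚᵘ.*≤* (subst₂ ℤ._≤_ (ℤP.pos-* a (suc d)) (ℤP.pos-* c (suc b)) (ℤ.+≤+ h)))))

frac-< : (a b c d : ℕ) → a * suc d <ℕ c * suc b → + a / suc b < + c / suc d
frac-< a b c d h = ℚP.toℚᵘ-cancel-<
  (ℚᵘP.<-respˡ-≃ (ℚᵘP.≃-sym (ℚP.toℚᵘ-fromℚᵘ (ℚᵘ.mkℚᵘ (+ a) b)))
    (ℚᵘP.<-respʳ-≃ (ℚᵘP.≃-sym (ℚP.toℚᵘ-fromℚᵘ (ℚᵘ.mkℚᵘ (+ c) d)))
      (ℚᵘ.*<* (subst₂ ℤ._<_ (ℤP.pos-* a (suc d)) (ℤP.pos-* c (suc b)) (ℤ.+<+ h)))))

win-arith : ∀ j d a → d ≤ℕ a + 2 → j ≤ℕ suc a → j * suc d ≤ℕ suc a * suc (suc j)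
win-arith j d a d≤ j≤ = begin
    j * suc d               ≤⟨ ℕP.*-monoʳ-≤ j (s≤s d≤) ⟩
    j * suc (a + 2)         ≡⟨ cong (j *_) (ℕP.+-comm (suc a) 2) ⟩
    j * (2 + suc a)         ≡⟨ ℕP.*-distribˡ-+ j 2 (suc a) ⟩
    j * 2 + j * suc a       ≤⟨ ℕP.+-mono-≤ (ℕP.*-monoˡ-≤ 2 j≤) (ℕP.≤-reflexive (ℕP.*-comm j (suc a))) ⟩
    suc a * 2 + suc a * j   ≡⟨ sym (ℕP.*-distribˡ-+ (suc a) 2 j) ⟩
    suc a * suc (suc j)     ∎
  where open ℕP.≤-Reasoning

lose-arith : ∀ a d → a ≤ℕ 1 → 1 ≤ℕ d → a * 2 ≤ℕ 1 * suc d
lose-arith a d a≤1 d≥1 = ℕP.≤-trans (ℕP.*-monoˡ-≤ 2 a≤1) (ℕP.≤-trans (s≤s d≥1) (ℕP.≤-reflexive (sym (ℕP.*-identityˡ _))))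

double-suc : ∀ m → 2 * suc m ≡ suc (suc (m + m))
double-suc m = trans (cong (λ k → suc m + k) (ℕP.+-identityʳ (suc m))) (cong suc (ℕP.+-suc m m))

≡ᵇ-true : ∀ {m n} → m ≡ n → (m ≡ᵇ n) ≡ true
≡ᵇ-true {m} {n} m≡n = Equivalence.to T-≡ (ℕP.≡⇒≡ᵇ m n m≡n)

≡ᵇ-sound : ∀ {m n} → (m ≡ᵇ n) ≡ true → m ≡ n
≡ᵇ-sound {m} {n} e = ℕP.≡ᵇ⇒≡ m n (Equivalence.from T-≡ e)

decided : ∀ {P : Set} (d : Dec P) → does d ≡ true → P
decided (yes p) _ = p

false≢true : false ≢ true
false≢true ()

not-isC : ∀ {s} → not (isC s) ≡ true → s ≡ D
not-isC {D} _ = refl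

module _ {A : Set} where

  any-none : ∀ (f : A → Bool) xs → (∀ x → f x ≡ false) → any f xs ≡ false
  any-none f [] none = refl
  any-none f (x ∷ xs) none rewrite none x = any-none f xs none

  any-some : ∀ (f : A → Bool) xs x → x ∈ xs → f x ≡ true → any f xs ≡ true
  any-some f (y ∷ xs) x (here refl) fx rewrite fx = refl
  any-some f (y ∷ xs) x (there x∈xs) fx with f y
  ... | true  = refl
  ... | false = any-some f xs x x∈xs fx

guard-mono : ∀ a {b c} → (a ≡ true → b ≡ true → c ≡ true) → a ∧ b ≡ true → a ∧ c ≡ true
guard-mono true b⇒c = b⇒c refl

guard-cong : ∀ a {b c} → (a ≡ true → b ≡ c) → a ∧ b ≡ a ∧ c
guard-cong true  b≡c = b≡c refl
guard-cong false b≡c = refl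

module Neighbourhoods {N : ℕ} (G : Graph N) where
  open Graph G using (adj; irrefl)

  inN-self : ∀ v → inN G v v ≡ true
  inN-self v rewrite dec-true (v ≟F v) refl = refl

  inN-adj : ∀ v u → adj v u ≡ true → inN G v u ≡ true
  inN-adj v u e rewrite e = ∨-zeroʳ _

  inN-cases : ∀ v u → inN G v u ≡ true → u ≡ v ⊎ adj v u ≡ true
  inN-cases v u e with u ≟F v
  ... | yes u≡v = inj₁ u≡v
  ... | no _    = inj₂ e

  countNbr-mono : ∀ v (p q : Fin N → Bool) → (∀ u → adj v u ≡ true → p u ≡ true → q u ≡ true) →
                  countNbr G v p ≤ℕ countNbr G v q
  countNbr-mono v p q p⇒q = count-mono _ _ (allFin N) λ u → guard-mono (adj v u) (p⇒q u)

  countNbr-none : ∀ v (p : Fin N → Bool) → (∀ u → adj v u ≡ true → p u ≡ false) → countNbr G v p ≡ 0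
  countNbr-none v p none = count-none _ (allFin N) λ u →
    trans (guard-cong (adj v u) (none u)) (∧-zeroʳ (adj v u))

  countNbr-witness : ∀ v (p : Fin N → Bool) → countNbr G v p ≢ 0 → ∃ λ u → adj v u ≡ true × p u ≡ true
  countNbr-witness v p nonzero with count-witness _ (allFin N) nonzero
  ... | u , e = u , ∧-conicalˡ _ _ e , ∧-conicalʳ _ _ e

  countNbr-split : ∀ v (p g : Fin N → Bool) →
                   countNbr G v p ≡ countNbr G v (λ u → p u ∧ g u) + countNbr G v (λ u → p u ∧ not (g u))
  countNbr-split v p g = trans (count-split _ g (allFin N))
    (cong₂ _+_ (count-cong _ _ (allFin N) λ u → ∧-assoc (adj v u) (p u) (g u))
               (count-cong _ _ (allFin N) λ u → ∧-assoc (adj v u) (p u) (not (g u))))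

  countNbr-∨ : ∀ v (p q : Fin N → Bool) → countNbr G v (λ u → p u ∨ q u) ≤ℕ countNbr G v p + countNbr G v q
  countNbr-∨ v p q = ℕP.≤-trans
    (ℕP.≤-reflexive (count-cong _ _ (allFin N) λ u → ∧-distribˡ-∨ (adj v u) (p u) (q u)))
    (count-∨ _ _ (allFin N))

  countN-closed : ∀ v (p : Fin N → Bool) → countN G v p ≡ (if p v then 1 else 0) + countNbr G v p
  countN-closed v p = begin
      countN G v p
    ≡⟨ count-split P isV (allFin N) ⟩
      count (λ u → P u ∧ isV u) (allFin N) + count (λ u → P u ∧ not (isV u)) (allFin N)
    ≡⟨ cong₂ _+_ (trans (count-cong _ _ (allFin N) atV) (self (p v)))
                 (count-cong _ _ (allFin N) awayFromV) ⟩
      (if p v then 1 else 0) + countNbr G v p ∎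
    where
      open ≡-Reasoning
      P isV : Fin N → Bool
      P u   = inN G v u ∧ p u
      isV u = does (u ≟F v)
      atV : ∀ u → P u ∧ isV u ≡ p v ∧ isV u
      atV u with u ≟F v
      ... | yes refl = refl
      ... | no _     = trans (∧-zeroʳ _) (sym (∧-zeroʳ (p v)))
      self : ∀ b → count (λ u → b ∧ isV u) (allFin N) ≡ (if b then 1 else 0)
      self true  = count-self v
      self false = count-none _ (allFin N) (λ _ → refl)
      awayFromV : ∀ u → P u ∧ not (isV u) ≡ adj v u ∧ p u
      awayFromV u with u ≟F v
      ... | yes refl rewrite irrefl u = ∧-zeroʳ _
      ... | no _     = ∧-identityʳ (adj v u ∧ p u)

module _ {A : Set} (g : A → Bool) (f : A → ℚ) where

  maxOver : List A → ℚ
  maxOver = foldr (λ u m → if g u then f u ⊔ m else m) 0ℚ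

  maxOver-upper : ∀ xs x → x ∈ xs → g x ≡ true → f x ≤ maxOver xs
  maxOver-upper (y ∷ xs) x (here refl) gx rewrite gx = ℚP.p≤p⊔q (f x) (maxOver xs)
  maxOver-upper (y ∷ xs) x (there x∈xs) gx with g y
  ... | true  = ℚP.≤-trans (maxOver-upper xs x x∈xs gx) (ℚP.p≤q⊔p (f y) (maxOver xs))
  ... | false = maxOver-upper xs x x∈xs gx

  maxOver-attained : ∀ xs → 0ℚ < maxOver xs → ∃ λ x → g x ≡ true × f x ≡ maxOver xs
  maxOver-attained [] pos = ⊥-elim (ℚP.<-irrefl refl pos)
  maxOver-attained (y ∷ xs) pos with g y in gy
  ... | false = maxOver-attained xs pos
  ... | true with ℚP.⊔-sel (f y) (maxOver xs)
  ...   | inj₁ fy = y , gy , sym fy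
  ...   | inj₂ rest with maxOver-attained xs (subst (0ℚ <_) rest pos)
  ...     | x , gx , fx = x , gx , trans fx (sym rest)

module Round {N : ℕ} (G : Graph N) (w : ℚ) (c : Config N) where
  open Neighbourhoods G

  maximalC maximalD : Fin N → Bool
  maximalC v = any (λ u → isMax G w c v u ∧ isC (c u)) (allFin N)
  maximalD v = any (λ u → isMax G w c v u ∧ not (isC (c u))) (allFin N)

  maxPower-upper : ∀ v x → inN G v x ≡ true → power G w c x ≤ maxPower G w c v
  maxPower-upper v x = maxOver-upper (inN G v) (power G w c) (allFin N) x (∈-allFin x)

  isMax-power : ∀ v u → isMax G w c v u ≡ true → power G w c u ≡ maxPower G w c v
  isMax-power v u maxU =
    decided isEqual (∧-conicalʳ (inN G v u) (does isEqual) maxU)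
    where
      isEqual : Dec (power G w c u ≡ maxPower G w c v)
      isEqual = power G w c u ≟ℚ maxPower G w c v

  maxPower-attained : ∀ v → 0ℚ < maxPower G w c v → ∃ λ u → inN G v u ≡ true × power G w c u ≡ maxPower G w c v
  maxPower-attained v pos = maxOver-attained (inN G v) (power G w c) (allFin N) pos

  isMax-intro : ∀ v u → inN G v u ≡ true → power G w c u ≡ maxPower G w c v → isMax G w c v u ≡ true
  isMax-intro v u u∈N pu = cong₂ _∧_ u∈N (dec-true (power G w c u ≟ℚ maxPower G w c v) pu)

  power-collaborator : ∀ x → c x ≡ C → wins G w c x ≡ true →
                       power G w c x ≡ + 1 / suc (countNbr G x (λ u → isC (c u)))
  power-collaborator x cx wx with c x | wins G w c x
  power-collaborator x refl refl | C | true = refl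

  power-defector : ∀ x → c x ≡ D → wins G w c x ≡ false →
                   power G w c x ≡ + 1 / suc (countNbr G x (λ u → not (isC (c u))))
  power-defector x dx lx with c x | wins G w c x
  power-defector x refl refl | D | false = refl

  rule : Bool → Bool → Strat → Strat
  rule true  false _ = C
  rule false true  _ = D
  rule _     _     s = s

  rule-C : ∀ m s → m ≡ true ⊎ s ≡ C → rule m false s ≡ C
  rule-C true  s _         = refl
  rule-C false s (inj₂ sC) = sC

  rule-D : ∀ d s → s ≡ D → rule false d s ≡ D
  rule-D true  s _  = refl
  rule-D false s sD = sD

  step-rule : ∀ v → step G w c v ≡ rule (maximalC v) (maximalD v) (c v)
  step-rule v with maximalC v | maximalD v
  ... | true  | true  = refl
  ... | true  | false = refl
  ... | false | true  = refl
  ... | false | false = refl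

  maximalC-of : ∀ v u → isMax G w c v u ≡ true → isC (c u) ≡ true → maximalC v ≡ true
  maximalC-of v u maxU cu = any-some _ (allFin N) u (∈-allFin u) (cong₂ _∧_ maxU cu)

  maximalD-of : ∀ v u → isMax G w c v u ≡ true → not (isC (c u)) ≡ true → maximalD v ≡ true
  maximalD-of v u maxU du = any-some _ (allFin N) u (∈-allFin u) (cong₂ _∧_ maxU du)

  maximalC-exists : ∀ v → maximalD v ≡ false → 0ℚ < maxPower G w c v → maximalC v ≡ true
  maximalC-exists v noD pos = fromMaximal (maxPower-attained v pos)
    where
      fromMaximal : (∃ λ u → inN G v u ≡ true × power G w c u ≡ maxPower G w c v) → maximalC v ≡ true
      fromMaximal (u , u∈N , pu) = byStrategy (isC (c u)) refl
        where
          maxU : isMax G w c v u ≡ true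
          maxU = isMax-intro v u u∈N pu
          byStrategy : ∀ b → isC (c u) ≡ b → maximalC v ≡ true
          byStrategy true  cu = maximalC-of v u maxU cu
          byStrategy false cu = ⊥-elim (false≢true (trans (sym noD) (maximalD-of v u maxU (cong not cu))))

  maximal-unbeaten : ∀ v u x → isMax G w c v u ≡ true → inN G v x ≡ true → ¬ (power G w c u < power G w c x)
  maximal-unbeaten v u x maxU x∈N u<x = ℚP.<-irrefl refl (ℚP.<-≤-trans u<x
    (subst (power G w c x ≤_) (sym (isMax-power v u maxU)) (maxPower-upper v x x∈N)))

  no-maximal-defector : ∀ v →
    (∀ u → inN G v u ≡ true → c u ≡ D → ∃ λ x → inN G v x ≡ true × power G w c u < power G w c x) →
    maximalD v ≡ false
  no-maximal-defector v beaten = any-none (λ u → isMax G w c v u ∧ not (isC (c u))) (allFin N)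
    λ u → notMaximal u (isMax G w c v u) refl (isC (c u)) refl
    where
      notMaximal : ∀ u m → isMax G w c v u ≡ m → ∀ b → isC (c u) ≡ b → m ∧ not b ≡ false
      notMaximal u false _    _     _  = refl
      notMaximal u true  _    true  _  = refl
      notMaximal u true  maxU false cu =
        let x , x∈N , u<x = beaten u (∧-conicalˡ _ _ maxU) (not-isC (cong not cu))
        in  ⊥-elim (maximal-unbeaten v u x maxU x∈N u<x)

  no-maximal-collaborator : ∀ v → (∀ u → inN G v u ≡ true → c u ≡ D) → maximalC v ≡ false
  no-maximal-collaborator v allD = any-none (λ u → isMax G w c v u ∧ isC (c u)) (allFin N)
    λ u → notMaximal u (isMax G w c v u) refl
    where
      notMaximal : ∀ u m → isMax G w c v u ≡ m → m ∧ isC (c u) ≡ false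
      notMaximal u false _    = refl
      notMaximal u true  maxU = cong isC (allD u (∧-conicalˡ _ _ maxU))

  step-C : ∀ v → maximalD v ≡ false →
           c v ≡ C ⊎ (∃ λ x → inN G v x ≡ true × 0ℚ < power G w c x) → step G w c v ≡ C
  step-C v noD reason = trans (step-rule v)
    (subst (λ d → rule (maximalC v) d (c v) ≡ C) (sym noD) (rule-C (maximalC v) (c v) (decide reason)))
    where
      decide : c v ≡ C ⊎ (∃ λ x → inN G v x ≡ true × 0ℚ < power G w c x) → maximalC v ≡ true ⊎ c v ≡ C
      decide (inj₁ cv)               = inj₂ cv
      decide (inj₂ (x , x∈N , pos)) = inj₁ (maximalC-exists v noD (ℚP.<-≤-trans pos (maxPower-upper v x x∈N)))

  step-D : ∀ v → (∀ u → inN G v u ≡ true → c u ≡ D) → step G w c v ≡ D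
  step-D v allD = trans (step-rule v)
    (subst (λ m → rule m (maximalD v) (c v) ≡ D) (sym (no-maximal-collaborator v allD))
      (rule-D (maximalD v) (c v) (allD v (inN-self v))))

module Layers (j n : ℕ) .{{_ : NonZero j}} {N : ℕ} (G : Graph N) (layer : Fin N → ℕ)
              (isG : IsGjn j n G layer) where
  open Graph G using (adj)
  open IsGjn isG
  open Neighbourhoods G

  adjacent-layers : ∀ v u → adj v u ≡ true →
                    layer u ≡ layer v ⊎ layer u ≡ suc (layer v) ⊎ suc (layer u) ≡ layer v
  adjacent-layers v u e with onlySucc v u e
  ... | inj₁ same         = inj₁ (sym same)
  ... | inj₂ (inj₁ up)    = inj₂ (inj₁ (sym up))
  ... | inj₂ (inj₂ down)  = inj₂ (inj₂ (sym down))

  near : ∀ v u → inN G v u ≡ true → layer u ≤ℕ suc (layer v) × layer v ≤ℕ suc (layer u)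
  near v u u∈N with inN-cases v u u∈N
  ... | inj₁ refl = ℕP.n≤1+n _ , ℕP.n≤1+n _
  ... | inj₂ e = close (adjacent-layers v u e)
    where
      close : ∀ {a b} → a ≡ b ⊎ a ≡ suc b ⊎ suc a ≡ b → a ≤ℕ suc b × b ≤ℕ suc a
      close (inj₁ refl)        = ℕP.n≤1+n _ , ℕP.n≤1+n _
      close (inj₂ (inj₁ refl)) = ℕP.≤-refl , ℕP.m≤n⇒m≤1+n (ℕP.n≤1+n _)
      close (inj₂ (inj₂ refl)) = ℕP.m≤n⇒m≤1+n (ℕP.n≤1+n _) , ℕP.≤-refl

  mates ups downs : Fin N → ℕ
  mates v = countNbr G v (λ u → layer u ≡ᵇ layer v)
  ups   v = countNbr G v (λ u → layer u ≡ᵇ suc (layer v))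
  downs v = countNbr G v (λ u → suc (layer u) ≡ᵇ layer v)

  layer-size : ∀ v → suc (mates v) ≡ 2 ^ layer v * j
  layer-size v = begin
      suc (mates v)
    ≡⟨ cong (_+ mates v) (cong (λ b → if b then 1 else 0) (sym (≡ᵇ-true {layer v} refl))) ⟩
      (if L v then 1 else 0) + mates v
    ≡⟨ sym (countN-closed v L) ⟩
      countN G v L
    ≡⟨ count-cong _ _ (allFin N) layerInN ⟩
      count L (allFin N)
    ≡⟨ layerSize (layer v) (layer≤ v) ⟩
      2 ^ layer v * j ∎
    where
      open ≡-Reasoning
      L : Fin N → Bool
      L u = layer u ≡ᵇ layer v
      layerInN : ∀ u → inN G v u ∧ L u ≡ L u
      layerInN u with L u in sameLayer | u ≟F v
      ... | false | _       = ∧-zeroʳ _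
      ... | true  | yes _    = refl
      ... | true  | no u≢v  = trans (∧-identityʳ _) (clique v u (u≢v ∘ sym) (sym (≡ᵇ-sound sameLayer)))

  j≤layer-size : ∀ v → j ≤ℕ suc (mates v)
  j≤layer-size v = subst (j ≤ℕ_) (sym (layer-size v)) (ℕP.m≤n*m j (2 ^ layer v) {{ℕP.m^n≢0 2 (layer v)}})

  mates-pos : ∀ v → 1 ≤ℕ layer v → 1 ≤ℕ mates v
  mates-pos v l≥1 = ℕ.s≤s⁻¹ (begin
      2                   ≤⟨ ℕP.^-monoʳ-≤ 2 l≥1 ⟩
      2 ^ layer v         ≤⟨ ℕP.m≤m*n (2 ^ layer v) j ⟩
      2 ^ layer v * j     ≡⟨ sym (layer-size v) ⟩
      suc (mates v)       ∎)
    where open ℕP.≤-Reasoning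

  layer-doubling : ∀ x u → layer x <ℕ layer u → 2 * suc (mates x) ≤ℕ suc (mates u)
  layer-doubling x u x<u = begin
      2 * suc (mates x)        ≡⟨ cong (2 *_) (layer-size x) ⟩
      2 * (2 ^ layer x * j)    ≡⟨ sym (ℕP.*-assoc 2 (2 ^ layer x) j) ⟩
      2 ^ suc (layer x) * j    ≤⟨ ℕP.*-monoˡ-≤ j (ℕP.^-monoʳ-≤ 2 x<u) ⟩
      2 ^ layer u * j          ≡⟨ sym (layer-size u) ⟩
      suc (mates u)            ∎
    where open ℕP.≤-Reasoning

  ups≤2 : ∀ v → ups v ≤ℕ 2
  ups≤2 v with layer v ℕ.<? n
  ... | yes below-top = ℕP.≤-reflexive (twoUp v below-top)
  ... | no  at-top    = ℕP.≤-trans (ℕP.≤-reflexive (countNbr-none v _ noUp)) z≤n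
    where
      noUp : ∀ u → adj v u ≡ true → (layer u ≡ᵇ suc (layer v)) ≡ false
      noUp u _ with layer u ≡ᵇ suc (layer v) in up
      ... | false = refl
      ... | true  = ⊥-elim (at-top (subst (_≤ℕ n) (≡ᵇ-sound up) (layer≤ u)))

  down-neighbour : ∀ v → 1 ≤ℕ layer v → ∃ λ x → adj v x ≡ true × suc (layer x) ≡ layer v
  down-neighbour v l≥1 with countNbr-witness v _ (λ zero-downs → ℕP.1+n≢0 (trans (sym (oneDown v l≥1)) zero-downs))
  ... | x , e , down = x , e , ≡ᵇ-sound down

  -- v has at most as many neighbours below as mates: none in the bottom layer,
  -- exactly one (against at least one mate) elsewhere.
  downs≤mates : ∀ v → downs v ≤ℕ mates v
  downs≤mates v = bound (layer v) refl
    where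
      bound : ∀ l → layer v ≡ l → downs v ≤ℕ mates v
      bound zero    lv = ℕP.≤-trans (ℕP.≤-reflexive (countNbr-none v _ noDown)) z≤n
        where
          noDown : ∀ u → adj v u ≡ true → (suc (layer u) ≡ᵇ layer v) ≡ false
          noDown u _ rewrite lv = refl
      bound (suc l) lv = ℕP.≤-trans (ℕP.≤-reflexive (oneDown v l≥1)) (mates-pos v l≥1)
        where
          l≥1 : 1 ≤ℕ layer v
          l≥1 = subst (1 ≤ℕ_) (sym lv) (s≤s z≤n)

  record Front (t : ℕ) (c : Config N) : Set where
    field
      collab : ∀ u → layer u ≤ℕ t → c u ≡ C
      defect : ∀ u → t <ℕ layer u → c u ≡ D

  module AtFront (w : ℚ) (½≤w : ½ ≤ w) (w<j/j+2 : w < + j / suc (suc j))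
                 (t : ℕ) (c : Config N) (front : Front t c) where
    open Front front
    open Round G w c

    collaborator-layer : ∀ u → isC (c u) ≡ true → layer u ≤ℕ t
    collaborator-layer u cu with layer u ℕ.≤? t
    ... | yes u≤t = u≤t
    ... | no  u≰t = ⊥-elim (false≢true (trans (sym (cong isC (defect u (ℕP.≰⇒> u≰t)))) cu))

    defector-layer : ∀ u → c u ≡ D → t <ℕ layer u
    defector-layer u du with layer u ℕ.≤? t
    ... | yes u≤t = ⊥-elim (false≢true (trans (sym (cong isC du)) (cong isC (collab u u≤t))))
    ... | no  u≰t = ℕP.≰⇒> u≰t

    nC nD deg : Fin N → ℕ
    nC x  = countNbr G x (λ u → isC (c u))
    nD x  = countNbr G x (λ u → not (isC (c u)))
    deg x = countNbr G x (λ _ → true)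

    -- A collaborator's defecting neighbours lie in the layer above: at most two.
    collab-nD≤2 : ∀ x → layer x ≤ℕ t → nD x ≤ℕ 2
    collab-nD≤2 x x≤t = ℕP.≤-trans (countNbr-mono x _ _ above) (ups≤2 x)
      where
        above : ∀ u → adj x u ≡ true → not (isC (c u)) ≡ true → (layer u ≡ᵇ suc (layer x)) ≡ true
        above u e du = ≡ᵇ-true (ℕP.≤-antisym (proj₁ (near x u (inN-adj x u e)))
                                             (ℕP.≤-trans (s≤s x≤t) (defector-layer u (not-isC du))))

    collab-mates : ∀ x → layer x ≤ℕ t → mates x ≤ℕ nC x
    collab-mates x x≤t = countNbr-mono x _ _ λ u _ same →
      cong isC (collab u (ℕP.≤-trans (ℕP.≤-reflexive (≡ᵇ-sound same)) x≤t))

    defect-mates : ∀ x → t <ℕ layer x → mates x ≤ℕ nD x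
    defect-mates x t<x = countNbr-mono x _ _ λ u _ same →
      cong (not ∘ isC) (defect u (ℕP.<-≤-trans t<x (ℕP.≤-reflexive (sym (≡ᵇ-sound same)))))

    -- A defector's collaborating neighbours lie in the layer below: at most one.
    defect-nC≤1 : ∀ x → t <ℕ layer x → nC x ≤ℕ 1
    defect-nC≤1 x t<x = ℕP.≤-trans (countNbr-mono x _ _ below) (ℕP.≤-reflexive (oneDown x (ℕP.≤-trans (s≤s z≤n) t<x)))
      where
        below : ∀ u → adj x u ≡ true → isC (c u) ≡ true → (suc (layer u) ≡ᵇ layer x) ≡ true
        below u e cu = ≡ᵇ-true (ℕP.≤-antisym (ℕP.≤-trans (s≤s (collaborator-layer u cu)) t<x)
                                             (proj₂ (near x u (inN-adj x u e))))

    front-nC : ∀ x → layer x ≡ t → nC x ≤ℕ mates x + downs x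
    front-nC x x≡t = ℕP.≤-trans (countNbr-mono x _ _ sameOrBelow) (countNbr-∨ x _ _)
      where
        sameOrBelow : ∀ u → adj x u ≡ true → isC (c u) ≡ true →
                      ((layer u ≡ᵇ layer x) ∨ (suc (layer u) ≡ᵇ layer x)) ≡ true
        sameOrBelow u e cu with adjacent-layers x u e
        ... | inj₁ same rewrite ≡ᵇ-true same = refl
        ... | inj₂ (inj₁ up) = ⊥-elim (ℕP.<-irrefl refl (begin-strict
                t               ≡⟨ sym x≡t ⟩
                layer x         <⟨ ℕP.n<1+n (layer x) ⟩
                suc (layer x)   ≡⟨ sym up ⟩
                layer u         ≤⟨ collaborator-layer u cu ⟩
                t               ∎))
          where open ℕP.≤-Reasoning
        ... | inj₂ (inj₂ down) rewrite ≡ᵇ-true down = ∨-zeroʳ _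

    deg-split : ∀ x → deg x ≡ nC x + nD x
    deg-split x = countNbr-split x (λ _ → true) (λ u → isC (c u))

    -- Collaborators win: their collaborator ratio is at least j/(j+2) > w.
    collab-wins : ∀ x → layer x ≤ℕ t → wins G w c x ≡ true
    collab-wins x x≤t = dec-true (w <? ratioC G w c x) (ℚP.<-≤-trans w<j/j+2 j/j+2≤ratio)
      where
        closed : countN G x (λ u → isC (c u)) ≡ suc (nC x)
        closed = trans (countN-closed x _) (cong (λ b → (if b then 1 else 0) + nC x) (cong isC (collab x x≤t)))
        deg≤ : deg x ≤ℕ nC x + 2
        deg≤ = ℕP.≤-trans (ℕP.≤-reflexive (deg-split x)) (ℕP.+-monoʳ-≤ (nC x) (collab-nD≤2 x x≤t))
        j≤ : j ≤ℕ suc (nC x)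
        j≤ = ℕP.≤-trans (j≤layer-size x) (s≤s (collab-mates x x≤t))
        j/j+2≤ratio : + j / suc (suc j) ≤ ratioC G w c x
        j/j+2≤ratio = subst (λ k → + j / suc (suc j) ≤ + k / suc (deg x)) (sym closed)
                        (frac-≤ j (suc j) (suc (nC x)) (deg x) (win-arith j (deg x) (nC x) deg≤ j≤))

    -- Defectors lose: their collaborator ratio is at most ½ ≤ w.
    defect-loses : ∀ x → t <ℕ layer x → wins G w c x ≡ false
    defect-loses x t<x = dec-false (w <? ratioC G w c x)
      λ w<ratio → ℚP.<-irrefl refl (ℚP.<-≤-trans w<ratio (ℚP.≤-trans ratio≤½ ½≤w))
      where
        closed : countN G x (λ u → isC (c u)) ≡ nC x
        closed = trans (countN-closed x _) (cong (λ b → (if b then 1 else 0) + nC x) (cong isC (defect x t<x)))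
        deg≥1 : 1 ≤ℕ deg x
        deg≥1 = ℕP.≤-trans (mates-pos x (ℕP.≤-trans (s≤s z≤n) t<x)) (countNbr-mono x _ _ λ _ _ _ → refl)
        ratio≤½ : ratioC G w c x ≤ ½
        ratio≤½ = subst (λ k → + k / suc (deg x) ≤ ½) (sym closed)
                    (frac-≤ (nC x) (deg x) 1 1 (lose-arith (nC x) (deg x) (defect-nC≤1 x t<x) deg≥1))

    power-collab : ∀ x → layer x ≤ℕ t → power G w c x ≡ + 1 / suc (nC x)
    power-collab x x≤t = power-collaborator x (collab x x≤t) (collab-wins x x≤t)

    power-defect : ∀ x → t <ℕ layer x → power G w c x ≡ + 1 / suc (nD x)
    power-defect x t<x = power-defector x (defect x t<x) (defect-loses x t<x)

    collab-positive : ∀ x → layer x ≤ℕ t → 0ℚ < power G w c x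
    collab-positive x x≤t = subst (0ℚ <_) (sym (power-collab x x≤t)) (frac-< 0 0 1 (nC x) (s≤s z≤n))

    -- A front collaborator has fewer collaborating neighbours than any defector has
    -- defecting ones, since the layer of the defector is at least twice as large.
    front-gap : ∀ x u → layer x ≡ t → t <ℕ layer u → nC x <ℕ nD u
    front-gap x u x≡t t<u = begin-strict
        nC x                    ≤⟨ front-nC x x≡t ⟩
        mates x + downs x       ≤⟨ ℕP.+-monoʳ-≤ (mates x) (downs≤mates x) ⟩
        mates x + mates x       <⟨ ℕ.s≤s⁻¹ (subst (_≤ℕ suc (mates u)) (double-suc (mates x)) doubling) ⟩
        mates u                 ≤⟨ defect-mates u t<u ⟩
        nD u                    ∎
      where
        open ℕP.≤-Reasoning
        doubling : 2 * suc (mates x) ≤ℕ suc (mates u)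
        doubling = layer-doubling x u (subst (_<ℕ layer u) (sym x≡t) t<u)

    front-beats : ∀ x u → layer x ≡ t → t <ℕ layer u → power G w c u < power G w c x
    front-beats x u x≡t t<u = subst₂ _<_ (sym (power-defect u t<u)) (sym (power-collab x (ℕP.≤-reflexive x≡t)))
      (frac-< 1 (nD u) 1 (nC x) (subst₂ _<ℕ_ (sym (ℕP.*-identityˡ _)) (sym (ℕP.*-identityˡ _)) (s≤s (front-gap x u x≡t t<u))))

    beaten-by-front : ∀ v x → inN G v x ≡ true → layer x ≡ t →
      ∀ u → inN G v u ≡ true → c u ≡ D → ∃ λ y → inN G v y ≡ true × power G w c u < power G w c y
    beaten-by-front v x x∈N x≡t u _ du = x , x∈N , front-beats x u x≡t (defector-layer u du)

    -- Vertices up to layer t keep collaborating: a defector in N[v] lies in layer t+1,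
    -- which forces v into the front layer t, where it beats that defector.
    step-behind : ∀ v → layer v ≤ℕ t → step G w c v ≡ C
    step-behind v v≤t = step-C v (no-maximal-defector v beaten) (inj₁ (collab v v≤t))
      where
        beaten : ∀ u → inN G v u ≡ true → c u ≡ D → ∃ λ y → inN G v y ≡ true × power G w c u < power G w c y
        beaten u u∈N du = beaten-by-front v v (inN-self v) v≡t u u∈N du
          where
            v≡t : layer v ≡ t
            v≡t = ℕP.≤-antisym v≤t (ℕ.s≤s⁻¹ (ℕP.≤-trans (defector-layer u du) (proj₁ (near v u u∈N))))

    -- Vertices of layer t+1 switch to collaborating, following their neighbour below.
    step-next : ∀ v → layer v ≡ suc t → step G w c v ≡ C
    step-next v v≡1+t = step-C v (no-maximal-defector v (beaten-by-front v x x∈N x≡t))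
                                 (inj₂ (x , x∈N , collab-positive x (ℕP.≤-reflexive x≡t)))
      where
        below : ∃ λ x → adj v x ≡ true × suc (layer x) ≡ layer v
        below = down-neighbour v (subst (1 ≤ℕ_) (sym v≡1+t) (s≤s z≤n))
        x : Fin N
        x = proj₁ below
        x∈N : inN G v x ≡ true
        x∈N = inN-adj v x (proj₁ (proj₂ below))
        x≡t : layer x ≡ t
        x≡t = ℕP.suc-injective (trans (proj₂ (proj₂ below)) v≡1+t)

    -- Vertices beyond layer t+1 see only defectors and keep defecting.
    step-ahead : ∀ v → suc t <ℕ layer v → step G w c v ≡ D
    step-ahead v 1+t<v = step-D v λ u u∈N →
      defect u (ℕ.s≤s⁻¹ (ℕP.≤-trans 1+t<v (proj₂ (near v u u∈N))))

    front-step : Front (suc t) (step G w c)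
    front-step = record
      { collab = λ v v≤1+t → [_,_] (step-behind v ∘ ℕ.s≤s⁻¹) (step-next v) (ℕP.m≤n⇒m<n∨m≡n v≤1+t)
      ; defect = step-ahead
      }

  front-init : Front 0 (initConfig layer)
  front-init = record { collab = bottom ; defect = above }
    where
      bottom : ∀ u → layer u ≤ℕ 0 → initConfig layer u ≡ C
      bottom u u≤0 with layer u
      ... | zero = refl
      above : ∀ u → 0 <ℕ layer u → initConfig layer u ≡ D
      above u 0<u with layer u
      ... | suc _ = refl

  front-complete : ∀ {t c} → n ≤ℕ t → Front t c → ∀ u → c u ≡ C
  front-complete n≤t front u = Front.collab front u (ℕP.≤-trans (layer≤ u) n≤t)

  front-process : ∀ w → ½ ≤ w → w < + j / suc (suc j) → ∀ t → Front t (process G w (initConfig layer) t)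
  front-process w ½≤w w<j/j+2 zero    = front-init
  front-process w ½≤w w<j/j+2 (suc t) = AtFront.front-step w ½≤w w<j/j+2 t _ (front-process w ½≤w w<j/j+2 t)

mainTheorem1 : (j n : ℕ) → .{{_ : NonZero j}} → .{{_ : NonZero n}} →
    {N : ℕ} (G : Graph N) (layer : Fin N → ℕ) → IsGjn j n G layer →
    (w : ℚ) → ½ ≤ w → w < 1ℚ → w < (+ j / suc (suc j)) →
    CollaboratorDominant G w (initConfig layer)
mainTheorem1 j n G layer isG w ½≤w _ w<j/j+2 =
  n , (λ u → trans (collaborates n ℕP.≤-refl u) (sym (collaborates (suc n) (ℕP.n≤1+n n) u))) ,
      collaborates n ℕP.≤-refl
  where
    open Layers j n G layer isG
    collaborates : ∀ t → n ≤ℕ t → ∀ u → process G w (initConfig layer) t u ≡ C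
    collaborates t n≤t = front-complete n≤t (front-process w ½≤w w<j/j+2 t)
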